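{- Let $X$ be an orientable map with transition matrix $U$. If $-1$ is not an eigenvalue of $U$, then $|V|=|F|$.
   Context: An orientable map $X$ is a 2-cell embedding of a finite connected multigraph (loops and parallel edges allowed) in a closed orientable surface, with vertex set $V$ and face set $F$. Each edge gives two arcs on opposite sides of it, pointing in opposite directions, each lying in a face and oriented along its clockwise facial walk. Let $\mathcal A$ be the arc set, $v(a)$ the tail vertex and $f(a)$ the face of arc $a$; $N\in\{0,1\}^{\mathcal A\times V}$ with $N(a,w)=1$ iff $w=v(a)$; $M\in\{0,1\}^{\mathcal A\times F}$ with $M(a,f)=1$ iff $f=f(a)$; $D=N^TN$, $\Delta=M^TM$; $\hat N=ND^{ -1/2}$, $\hat M=M\Delta^{ -1/2}$, $Q=\hat N\hat N^T$, $P=\hat M\hat M^T$; the transition matrix is $U=(2P-I)(2Q-I)$. -}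

module Defs where

open import Data.Nat using (ℕ; zero; suc)
open import Data.Fin using (Fin)
open import Data.Fin.Properties using (_≟_)
open import Data.Rational as ℚ using (ℚ; 0ℚ; 1ℚ; _+_; _*_; -_; _-_)
import Data.Rational.Properties as ℚP
open import Data.Product using (Σ; ∃; _×_; _,_)
open import Relation.Binary.PropositionalEquality using (_≡_; _≢_)
open import Relation.Nullary using (yes; no)
open import Function.Definitions using (Injective; Surjective)
open import Function.Bundles using (_⇔_)

_^[_] : ∀ {A : Set} → (A → A) → ℕ → A → A
(f ^[ zero ]) x = x
(f ^[ suc k ]) x = f ((f ^[ k ]) x)

data Reach {n : ℕ} (r φ : Fin n → Fin n) : Fin n → Fin n → Set where
  here  : ∀ {a} → Reach r φ a a
  viaR  : ∀ {a b} → Reach r φ (r a) b → Reach r φ a b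
  viaΦ  : ∀ {a b} → Reach r φ (φ a) b → Reach r φ a b

-- An orientable map: arc set Fin nA, vertex set Fin nV, face set Fin nF.
--   rev a  : the arc on the opposite side of the same edge (opposite direction)
--   next a : the arc following a along the clockwise facial walk of f(a)
--   tail a : v(a),   face a : f(a)
-- Vertices are exactly the orbits of (next ∘ rev) (the arcs leaving a vertex),
-- faces are exactly the orbits of next; connectedness = transitivity.
record OrientableMap : Set where
  field
    nA nV nF : ℕ
    rev  : Fin nA → Fin nA
    next : Fin nA → Fin nA
    tail : Fin nA → Fin nV
    face : Fin nA → Fin nF
    rev-invol      : ∀ a → rev (rev a) ≡ a
    rev-fixfree    : ∀ a → rev a ≢ a
    next-inj       : Injective _≡_ _≡_ next
    tail-surj      : Surjective _≡_ _≡_ tail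
    face-surj      : Surjective _≡_ _≡_ face
    tail-orbits    : ∀ a b → (tail a ≡ tail b) ⇔ (∃ λ k → ((λ x → next (rev x)) ^[ k ]) a ≡ b)
    face-orbits    : ∀ a b → (face a ≡ face b) ⇔ (∃ λ k → (next ^[ k ]) a ≡ b)
    connected      : ∀ a b → Reach rev next a b

Mat : ℕ → ℕ → Set
Mat m n = Fin m → Fin n → ℚ

sumℚ : ∀ {n} → (Fin n → ℚ) → ℚ
sumℚ {zero}  f = 0ℚ
sumℚ {suc n} f = f Fin.zero + sumℚ (λ i → f (Fin.suc i))

infixl 7 _·_
_·_ : ∀ {m k n} → Mat m k → Mat k n → Mat m n
(A · B) i j = sumℚ (λ l → A i l * B l j)

infixl 6 _⊕_ _⊖_
_⊕_ _⊖_ : ∀ {m n} → Mat m n → Mat m n → Mat m n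
(A ⊕ B) i j = A i j + B i j
(A ⊖ B) i j = A i j - B i j

_ᵀ : ∀ {m n} → Mat m n → Mat n m
(A ᵀ) i j = A j i

scale : ∀ {m n} → ℚ → Mat m n → Mat m n
scale c A i j = c * A i j

δ : ∀ {n} → Fin n → Fin n → ℚ
δ i j with i ≟ j
... | yes _ = 1ℚ
... | no  _ = 0ℚ

I : ∀ {n} → Mat n n
I = δ

-- inverse of a diagonal matrix (entries that are 0 are left as 0;
-- in a map all diagonal entries of D and Δ are positive degrees)
recip : ℚ → ℚ
recip q with q ℚP.≟ 0ℚ
... | yes _ = 0ℚ
... | no q≢0 = ℚ.1/_ q {{ℚ.≢-nonZero q≢0}}

diagInv : ∀ {n} → Mat n n → Mat n n
diagInv A i j = recip (A i i) * δ i j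

module _ (X : OrientableMap) where
  open OrientableMap X

  Nmat : Mat nA nV
  Nmat a w = δ (tail a) w

  Mmat : Mat nA nF
  Mmat a f = δ (face a) f

  Dmat : Mat nV nV
  Dmat = (Nmat ᵀ) · Nmat

  Δmat : Mat nF nF
  Δmat = (Mmat ᵀ) · Mmat

  -- Q = N̂ N̂ᵀ = N D^{-1/2} D^{-1/2} Nᵀ = N D⁻¹ Nᵀ  (D diagonal)
  Qmat : Mat nA nA
  Qmat = Nmat · diagInv Dmat · (Nmat ᵀ)

  -- P = M̂ M̂ᵀ = M Δ⁻¹ Mᵀ
  Pmat : Mat nA nA
  Pmat = Mmat · diagInv Δmat · (Mmat ᵀ)

  Umat : Mat nA nA
  Umat = (scale (1ℚ + 1ℚ) Pmat ⊖ I) · (scale (1ℚ + 1ℚ) Qmat ⊖ I)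

IsEigenvalue : ∀ {n} → Mat n n → ℚ → Set
IsEigenvalue {n} A λ' =
  Σ (Fin n → ℚ) λ x → (∃ λ a → x a ≢ 0ℚ) ×
    (∀ a → sumℚ (λ b → A a b * x b) ≡ λ' * x a)

-- If |V| < |F|, the V × F matrix Nᵀ M has a nonzero kernel vector z (Gaussian
-- elimination).  Spread over the arcs face by face, x = M z is fixed by the face
-- projection P, and Nᵀ x = 0 means it is killed by the vertex projection Q; hence
-- U x = (2P - I)(-x) = -x.  If |F| < |V|, a kernel vector of Mᵀ N spread over the arcs
-- vertex by vertex is fixed by Q and killed by P, and again U x = -x.
module Submission where

open import Defs
open import Data.Rational using (-_; 1ℚ)
open import Relation.Nullary using (¬_)
open import Relation.Binary.PropositionalEquality using (_≡_)

open import Algebra.Bundles using (CommutativeRing)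
import Data.Rational.Properties as ℚP
open import Algebra.Properties.Semiring.Sum (CommutativeRing.semiring ℚP.+-*-commutativeRing)
  using (sum; sum-cong-≗; sum-replicate-zero; sum-remove; ∑-distrib-+; ∑-comm; *-distribˡ-sum; *-distribʳ-sum)
open import Data.Empty using (⊥-elim)
open import Data.Fin using (Fin; zero; suc; punchIn; punchOut)
open import Data.Fin.Properties using (_≟_; all?; ¬∀⟶∃¬; punchInᵢ≢i; punchIn-punchOut)
open import Data.Nat as ℕ using (ℕ; s≤s)
open import Data.Nat.Properties using (<-cmp)
open import Data.Product using (Σ; ∃; _×_; _,_)
open import Data.Rational as ℚ using (ℚ; 0ℚ; _+_; _*_; _-_; _≤_; _<_)
open import Function.Base using (_∘_)
open import Level using (0ℓ)
open import Function.Definitions using (Surjective)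
open import Relation.Binary using (tri<; tri≈; tri>)
open import Relation.Binary.PropositionalEquality
  using (_≢_; _≗_; refl; sym; trans; cong; cong₂; subst; module ≡-Reasoning)
open import Relation.Nullary using (yes; no)
open import Relation.Nullary.Decidable using (dec⇒maybe)
open import Tactic.RingSolver using (solve-∀)
open import Tactic.RingSolver.Core.AlmostCommutativeRing using (AlmostCommutativeRing; fromCommutativeRing)

open ≡-Reasoning

ℚ-almostCommutativeRing : AlmostCommutativeRing 0ℓ 0ℓ
ℚ-almostCommutativeRing = fromCommutativeRing ℚP.+-*-commutativeRing (λ q → dec⇒maybe (0ℚ ℚP.≟ q))

sumℚ≡sum : ∀ {n} (f : Fin n → ℚ) → sumℚ f ≡ sum f
sumℚ≡sum {ℕ.zero}  f = refl
sumℚ≡sum {ℕ.suc n} f = cong (f zero +_) (sumℚ≡sum (λ i → f (suc i)))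

sumℚ-cong : ∀ {n} {f g : Fin n → ℚ} → f ≗ g → sumℚ f ≡ sumℚ g
sumℚ-cong {f = f} {g} f≗g = trans (sumℚ≡sum f) (trans (sum-cong-≗ f≗g) (sym (sumℚ≡sum g)))

sumℚ-zero : ∀ {n} {f : Fin n → ℚ} → (∀ i → f i ≡ 0ℚ) → sumℚ f ≡ 0ℚ
sumℚ-zero {n} {f} f≡0 = trans (sumℚ≡sum f) (trans (sum-cong-≗ f≡0) (sum-replicate-zero n))

sumℚ-distrib-+ : ∀ {n} (f g : Fin n → ℚ) → sumℚ (λ i → f i + g i) ≡ sumℚ f + sumℚ g
sumℚ-distrib-+ f g = begin
  sumℚ (λ i → f i + g i) ≡⟨ sumℚ≡sum (λ i → f i + g i) ⟩
  sum (λ i → f i + g i)  ≡⟨ ∑-distrib-+ f g ⟩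
  sum f + sum g          ≡⟨ cong₂ _+_ (sumℚ≡sum f) (sumℚ≡sum g) ⟨
  sumℚ f + sumℚ g        ∎

*-distribˡ-sumℚ : ∀ {n} c (f : Fin n → ℚ) → c * sumℚ f ≡ sumℚ (λ i → c * f i)
*-distribˡ-sumℚ c f = begin
  c * sumℚ f             ≡⟨ cong (c *_) (sumℚ≡sum f) ⟩
  c * sum f              ≡⟨ *-distribˡ-sum c f ⟩
  sum (λ i → c * f i)    ≡⟨ sumℚ≡sum (λ i → c * f i) ⟨
  sumℚ (λ i → c * f i)   ∎

*-distribʳ-sumℚ : ∀ {n} c (f : Fin n → ℚ) → sumℚ f * c ≡ sumℚ (λ i → f i * c)
*-distribʳ-sumℚ c f = begin
  sumℚ f * c             ≡⟨ cong (_* c) (sumℚ≡sum f) ⟩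
  sum f * c              ≡⟨ *-distribʳ-sum c f ⟩
  sum (λ i → f i * c)    ≡⟨ sumℚ≡sum (λ i → f i * c) ⟨
  sumℚ (λ i → f i * c)   ∎

sumℚ-comm : ∀ {m n} (f : Fin m → Fin n → ℚ) →
            sumℚ (λ i → sumℚ (λ j → f i j)) ≡ sumℚ (λ j → sumℚ (λ i → f i j))
sumℚ-comm f = begin
  sumℚ (λ i → sumℚ (λ j → f i j)) ≡⟨ sumℚ-cong (λ i → sumℚ≡sum (f i)) ⟩
  sumℚ (λ i → sum (λ j → f i j))  ≡⟨ sumℚ≡sum (λ i → sum (f i)) ⟩
  sum (λ i → sum (λ j → f i j))   ≡⟨ ∑-comm f ⟩
  sum (λ j → sum (λ i → f i j))   ≡⟨ sumℚ≡sum (λ j → sum (λ i → f i j)) ⟨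
  sumℚ (λ j → sum (λ i → f i j))  ≡⟨ sumℚ-cong (λ j → sumℚ≡sum (λ i → f i j)) ⟨
  sumℚ (λ j → sumℚ (λ i → f i j)) ∎

neg-distrib-sumℚ : ∀ {n} (f : Fin n → ℚ) → - sumℚ f ≡ sumℚ (λ i → - f i)
neg-distrib-sumℚ {ℕ.zero}  f = refl
neg-distrib-sumℚ {ℕ.suc n} f =
  trans (ℚP.neg-distrib-+ (f zero) _) (cong (- f zero +_) (neg-distrib-sumℚ (λ i → f (suc i))))

δ-≡ : ∀ {n} {i j : Fin n} → i ≡ j → δ i j ≡ 1ℚ
δ-≡ {i = i} {j} i≡j with i ≟ j
... | yes _   = refl
... | no  i≢j = ⊥-elim (i≢j i≡j)

δ-≢ : ∀ {n} {i j : Fin n} → i ≢ j → δ i j ≡ 0ℚ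
δ-≢ {i = i} {j} i≢j with i ≟ j
... | yes i≡j = ⊥-elim (i≢j i≡j)
... | no  _   = refl

δ-nonNegative : ∀ {n} (i j : Fin n) → 0ℚ ≤ δ i j
δ-nonNegative i j with i ≟ j
... | yes _ = ℚP.nonNegative⁻¹ 1ℚ
... | no  _ = ℚP.≤-refl

δ-*-transport : ∀ {n} (i j : Fin n) (y : Fin n → ℚ) → δ i j * y i ≡ δ i j * y j
δ-*-transport i j y with i ≟ j
... | yes refl = refl
... | no  _    = trans (ℚP.*-zeroˡ (y i)) (sym (ℚP.*-zeroˡ (y j)))

sumℚ-δ : ∀ {n} (i : Fin n) (y : Fin n → ℚ) → sumℚ (λ j → δ i j * y j) ≡ y i
sumℚ-δ {ℕ.suc n} i y = begin
  sumℚ t                              ≡⟨ sumℚ≡sum t ⟩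
  sum t                               ≡⟨ sum-remove {i = i} t ⟩
  t i + sum (λ j → t (punchIn i j))   ≡⟨ cong₂ _+_ picked (trans (sum-cong-≗ punched) (sum-replicate-zero n)) ⟩
  y i + 0ℚ                            ≡⟨ ℚP.+-identityʳ (y i) ⟩
  y i                                 ∎
  where
  t : Fin (ℕ.suc n) → ℚ
  t j = δ i j * y j
  picked : t i ≡ y i
  picked = trans (cong (_* y i) (δ-≡ {i = i} refl)) (ℚP.*-identityˡ (y i))
  punched : ∀ j → t (punchIn i j) ≡ 0ℚ
  punched j = trans (cong (_* y (punchIn i j)) (δ-≢ (punchInᵢ≢i i j ∘ sym))) (ℚP.*-zeroˡ (y (punchIn i j)))

sumℚ-nonNegative : ∀ {n} (f : Fin n → ℚ) → (∀ i → 0ℚ ≤ f i) → 0ℚ ≤ sumℚ f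
sumℚ-nonNegative {ℕ.zero}  f f≥0 = ℚP.≤-refl
sumℚ-nonNegative {ℕ.suc n} f f≥0 =
  ℚP.+-mono-≤ (f≥0 zero) (sumℚ-nonNegative (λ i → f (suc i)) (λ i → f≥0 (suc i)))

sumℚ-positive : ∀ {n} (f : Fin n → ℚ) → (∀ i → 0ℚ ≤ f i) → ∀ i → 0ℚ < f i → 0ℚ < sumℚ f
sumℚ-positive f f≥0 zero    f₀>0 =
  ℚP.+-mono-<-≤ f₀>0 (sumℚ-nonNegative (λ i → f (suc i)) (λ i → f≥0 (suc i)))
sumℚ-positive f f≥0 (suc i) fᵢ>0 =
  ℚP.+-mono-≤-< (f≥0 zero) (sumℚ-positive (λ i → f (suc i)) (λ i → f≥0 (suc i)) i fᵢ>0)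

infixr 7 _*ᵥ_

_*ᵥ_ : ∀ {m n} → Mat m n → (Fin n → ℚ) → Fin m → ℚ
(A *ᵥ x) i = sumℚ (λ j → A i j * x j)

*ᵥ-congʳ : ∀ {m n} (A : Mat m n) {x y : Fin n → ℚ} → x ≗ y → A *ᵥ x ≗ A *ᵥ y
*ᵥ-congʳ A x≗y i = sumℚ-cong (λ j → cong (A i j *_) (x≗y j))

·-*ᵥ-assoc : ∀ {m k n} (A : Mat m k) (B : Mat k n) (x : Fin n → ℚ) → (A · B) *ᵥ x ≗ A *ᵥ (B *ᵥ x)
·-*ᵥ-assoc A B x i = begin
  sumℚ (λ j → sumℚ (λ l → A i l * B l j) * x j)   ≡⟨ sumℚ-cong (λ j → *-distribʳ-sumℚ (x j) (λ l → A i l * B l j)) ⟩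
  sumℚ (λ j → sumℚ (λ l → A i l * B l j * x j))   ≡⟨ sumℚ-comm (λ j l → A i l * B l j * x j) ⟩
  sumℚ (λ l → sumℚ (λ j → A i l * B l j * x j))   ≡⟨ sumℚ-cong (λ l → sumℚ-cong (λ j → ℚP.*-assoc (A i l) (B l j) (x j))) ⟩
  sumℚ (λ l → sumℚ (λ j → A i l * (B l j * x j))) ≡⟨ sumℚ-cong (λ l → *-distribˡ-sumℚ (A i l) (λ j → B l j * x j)) ⟨
  sumℚ (λ l → A i l * (B *ᵥ x) l)                 ∎

I-*ᵥ : ∀ {n} (x : Fin n → ℚ) → I *ᵥ x ≗ x
I-*ᵥ x i = sumℚ-δ i x

diagInv-*ᵥ : ∀ {n} (A : Mat n n) (x : Fin n → ℚ) → diagInv A *ᵥ x ≗ λ i → recip (A i i) * x i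
diagInv-*ᵥ A x i = begin
  sumℚ (λ j → recip (A i i) * δ i j * x j)   ≡⟨ sumℚ-cong (λ j → ℚP.*-assoc (recip (A i i)) (δ i j) (x j)) ⟩
  sumℚ (λ j → recip (A i i) * (δ i j * x j)) ≡⟨ *-distribˡ-sumℚ (recip (A i i)) (λ j → δ i j * x j) ⟨
  recip (A i i) * sumℚ (λ j → δ i j * x j)   ≡⟨ cong (recip (A i i) *_) (sumℚ-δ i x) ⟩
  recip (A i i) * x i                        ∎

scale-⊖-I-*ᵥ : ∀ {n} c (A : Mat n n) (x : Fin n → ℚ) → (scale c A ⊖ I) *ᵥ x ≗ λ i → c * (A *ᵥ x) i - x i
scale-⊖-I-*ᵥ c A x i = begin
  sumℚ (λ j → (c * A i j - δ i j) * x j)                  ≡⟨ sumℚ-cong (λ j → expand c (A i j) (δ i j) (x j)) ⟩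
  sumℚ (λ j → c * (A i j * x j) + - (δ i j * x j))        ≡⟨ sumℚ-distrib-+ (λ j → c * (A i j * x j)) (λ j → - (δ i j * x j)) ⟩
  sumℚ (λ j → c * (A i j * x j)) + sumℚ (λ j → - (δ i j * x j))
    ≡⟨ cong₂ _+_ (*-distribˡ-sumℚ c (λ j → A i j * x j)) (neg-distrib-sumℚ (λ j → δ i j * x j)) ⟨
  c * (A *ᵥ x) i - (I *ᵥ x) i                             ≡⟨ cong (λ t → c * (A *ᵥ x) i - t) (I-*ᵥ x i) ⟩
  c * (A *ᵥ x) i - x i                                    ∎
  where
  expand : ∀ c a d y → (c * a - d) * y ≡ c * (a * y) + - (d * y)
  expand = solve-∀ ℚ-almostCommutativeRing

reflection : ∀ {n} → Mat n n → Mat n n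
reflection A = scale (1ℚ + 1ℚ) A ⊖ I

reflection-fixes : ∀ {n} (A : Mat n n) {x : Fin n → ℚ} → A *ᵥ x ≗ x → reflection A *ᵥ x ≗ x
reflection-fixes A {x} Ax≗x i = begin
  (reflection A *ᵥ x) i        ≡⟨ scale-⊖-I-*ᵥ (1ℚ + 1ℚ) A x i ⟩
  (1ℚ + 1ℚ) * (A *ᵥ x) i - x i ≡⟨ cong (λ t → (1ℚ + 1ℚ) * t - x i) (Ax≗x i) ⟩
  (1ℚ + 1ℚ) * x i - x i        ≡⟨ twice-minus (x i) ⟩
  x i                          ∎
  where
  twice-minus : ∀ t → (1ℚ + 1ℚ) * t - t ≡ t
  twice-minus = solve-∀ ℚ-almostCommutativeRing

reflection-negates : ∀ {n} (A : Mat n n) {x : Fin n → ℚ} → A *ᵥ x ≗ (λ _ → 0ℚ) →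
                     reflection A *ᵥ x ≗ λ i → - x i
reflection-negates A {x} Ax≗0 i = begin
  (reflection A *ᵥ x) i        ≡⟨ scale-⊖-I-*ᵥ (1ℚ + 1ℚ) A x i ⟩
  (1ℚ + 1ℚ) * (A *ᵥ x) i - x i ≡⟨ cong (λ t → (1ℚ + 1ℚ) * t - x i) (Ax≗0 i) ⟩
  (1ℚ + 1ℚ) * 0ℚ - x i         ≡⟨ twice-zero-minus (x i) ⟩
  - x i                        ∎
  where
  twice-zero-minus : ∀ t → (1ℚ + 1ℚ) * 0ℚ - t ≡ - t
  twice-zero-minus = solve-∀ ℚ-almostCommutativeRing

recip-*-inverse : ∀ q → q ≢ 0ℚ → recip q * q ≡ 1ℚ
recip-*-inverse q q≢0 with q ℚP.≟ 0ℚ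
... | yes q≡0 = ⊥-elim (q≢0 q≡0)
... | no  q≢0 = ℚP.*-inverseˡ q {{ℚ.≢-nonZero q≢0}}

-- Nmat X, Dmat X, Qmat X are incidence tail, its Gram matrix and projection tail
-- definitionally, and likewise for Mmat X, Δmat X, Pmat X with face.
module Incidence {n k : ℕ} (g : Fin n → Fin k) where

  incidence : Mat n k
  incidence a f = δ (g a) f

  degree : Fin k → ℚ
  degree f = sumℚ (λ a → δ (g a) f)

  projection : Mat n n
  projection = incidence · diagInv ((incidence ᵀ) · incidence) · (incidence ᵀ)

  incidence-*ᵥ : ∀ z → incidence *ᵥ z ≗ z ∘ g
  incidence-*ᵥ z a = sumℚ-δ (g a) z

  incidenceᵀ-*ᵥ-∘ : ∀ z → (incidence ᵀ) *ᵥ (z ∘ g) ≗ λ f → degree f * z f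
  incidenceᵀ-*ᵥ-∘ z f = begin
    sumℚ (λ a → δ (g a) f * z (g a)) ≡⟨ sumℚ-cong (λ a → δ-*-transport (g a) f z) ⟩
    sumℚ (λ a → δ (g a) f * z f)     ≡⟨ *-distribʳ-sumℚ (z f) (λ a → δ (g a) f) ⟨
    degree f * z f                   ∎

  gram-diagonal : ∀ f → ((incidence ᵀ) · incidence) f f ≡ degree f
  gram-diagonal f = begin
    ((incidence ᵀ) *ᵥ ((λ i → δ i f) ∘ g)) f ≡⟨ incidenceᵀ-*ᵥ-∘ (λ i → δ i f) f ⟩
    degree f * δ f f                         ≡⟨ cong (degree f *_) (δ-≡ {i = f} refl) ⟩
    degree f * 1ℚ                            ≡⟨ ℚP.*-identityʳ (degree f) ⟩
    degree f                                 ∎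

  degree-positive : ∀ a → 0ℚ < degree (g a)
  degree-positive a = sumℚ-positive (λ b → δ (g b) (g a)) (λ b → δ-nonNegative (g b) (g a)) a
    (subst (0ℚ <_) (sym (δ-≡ {i = g a} refl)) (ℚP.positive⁻¹ 1ℚ))

  projection-*ᵥ : ∀ x → projection *ᵥ x ≗ λ a → recip (degree (g a)) * ((incidence ᵀ) *ᵥ x) (g a)
  projection-*ᵥ x a = begin
    (projection *ᵥ x) a                                 ≡⟨ ·-*ᵥ-assoc (incidence · Λ) (incidence ᵀ) x a ⟩
    ((incidence · Λ) *ᵥ y) a                            ≡⟨ ·-*ᵥ-assoc incidence Λ y a ⟩
    (incidence *ᵥ (Λ *ᵥ y)) a                           ≡⟨ incidence-*ᵥ (Λ *ᵥ y) a ⟩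
    (Λ *ᵥ y) (g a)                                      ≡⟨ diagInv-*ᵥ ((incidence ᵀ) · incidence) y (g a) ⟩
    recip (((incidence ᵀ) · incidence) (g a) (g a)) * y (g a)
      ≡⟨ cong (λ t → recip t * y (g a)) (gram-diagonal (g a)) ⟩
    recip (degree (g a)) * y (g a)                      ∎
    where
    Λ : Mat k k
    Λ = diagInv ((incidence ᵀ) · incidence)
    y : Fin k → ℚ
    y = (incidence ᵀ) *ᵥ x

  projection-kills : ∀ {x} → (incidence ᵀ) *ᵥ x ≗ (λ _ → 0ℚ) → projection *ᵥ x ≗ (λ _ → 0ℚ)
  projection-kills {x} y≗0 a = begin
    (projection *ᵥ x) a                                 ≡⟨ projection-*ᵥ x a ⟩
    recip (degree (g a)) * ((incidence ᵀ) *ᵥ x) (g a)   ≡⟨ cong (recip (degree (g a)) *_) (y≗0 (g a)) ⟩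
    recip (degree (g a)) * 0ℚ                           ≡⟨ ℚP.*-zeroʳ (recip (degree (g a))) ⟩
    0ℚ                                                  ∎

  projection-fixes-∘ : ∀ z → projection *ᵥ (z ∘ g) ≗ z ∘ g
  projection-fixes-∘ z a = begin
    (projection *ᵥ (z ∘ g)) a                           ≡⟨ projection-*ᵥ (z ∘ g) a ⟩
    recip d * ((incidence ᵀ) *ᵥ (z ∘ g)) (g a)          ≡⟨ cong (recip d *_) (incidenceᵀ-*ᵥ-∘ z (g a)) ⟩
    recip d * (d * z (g a))                             ≡⟨ ℚP.*-assoc (recip d) d (z (g a)) ⟨
    recip d * d * z (g a)                               ≡⟨ cong (_* z (g a)) (recip-*-inverse d d≢0) ⟩
    1ℚ * z (g a)                                        ≡⟨ ℚP.*-identityˡ (z (g a)) ⟩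
    z (g a)                                             ∎
    where
    d : ℚ
    d = degree (g a)
    d≢0 : d ≢ 0ℚ
    d≢0 = ℚP.<⇒≢ (degree-positive a) ∘ sym

NontrivialKernel : ∀ {m n} → Mat m n → Set
NontrivialKernel {n = n} A = Σ (Fin n → ℚ) λ z → (∃ λ j → z j ≢ 0ℚ) × (A *ᵥ z ≗ λ _ → 0ℚ)

zeroFirstColumn⇒kernel : ∀ {m n} (A : Mat m (ℕ.suc n)) → (∀ i → A i zero ≡ 0ℚ) → NontrivialKernel A
zeroFirstColumn⇒kernel {n = n} A col≡0 = e₀ , (zero , λ ()) , kills
  where
  e₀ : Fin (ℕ.suc n) → ℚ
  e₀ zero    = 1ℚ
  e₀ (suc _) = 0ℚ
  kills : A *ᵥ e₀ ≗ λ _ → 0ℚ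
  kills i = cong₂ _+_ (trans (cong (_* 1ℚ) (col≡0 i)) (ℚP.*-zeroˡ 1ℚ))
                      (sumℚ-zero (λ j → ℚP.*-zeroʳ (A i (suc j))))

pivotStep : ∀ {m n} → Mat m (ℕ.suc n) → Fin m → Mat m n
pivotStep A p r j = A r (suc j) - A r zero * recip (A p zero) * A p (suc j)

module PivotStep {m n} (A : Mat m (ℕ.suc n)) (p : Fin m) (w : Fin n → ℚ) where

  S : Fin m → ℚ
  S r = sumℚ (λ j → A r (suc j) * w j)

  extend : Fin (ℕ.suc n) → ℚ
  extend zero    = - (S p * recip (A p zero))
  extend (suc j) = w j

  pivotStep-*ᵥ : ∀ r → (pivotStep A p *ᵥ w) r ≡ S r - A r zero * recip (A p zero) * S p
  pivotStep-*ᵥ r = begin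
    sumℚ (λ j → (A r (suc j) - c * A p (suc j)) * w j)   ≡⟨ sumℚ-cong (λ j → expand (A r (suc j)) c (A p (suc j)) (w j)) ⟩
    sumℚ (λ j → A r (suc j) * w j + - (c * (A p (suc j) * w j)))
      ≡⟨ sumℚ-distrib-+ (λ j → A r (suc j) * w j) (λ j → - (c * (A p (suc j) * w j))) ⟩
    S r + sumℚ (λ j → - (c * (A p (suc j) * w j)))      ≡⟨ cong (S r +_) (neg-distrib-sumℚ (λ j → c * (A p (suc j) * w j))) ⟨
    S r - sumℚ (λ j → c * (A p (suc j) * w j))          ≡⟨ cong (λ t → S r - t) (*-distribˡ-sumℚ c (λ j → A p (suc j) * w j)) ⟨
    S r - c * S p                                       ∎
    where
    c : ℚ
    c = A r zero * recip (A p zero)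
    expand : ∀ a c b y → (a - c * b) * y ≡ a * y + - (c * (b * y))
    expand = solve-∀ ℚ-almostCommutativeRing

  extend-*ᵥ : ∀ r → (A *ᵥ extend) r ≡ (pivotStep A p *ᵥ w) r
  extend-*ᵥ r = trans (rearrange (A r zero) (S p) (recip (A p zero)) (S r)) (sym (pivotStep-*ᵥ r))
    where
    rearrange : ∀ a s ι t → a * - (s * ι) + t ≡ t - a * ι * s
    rearrange = solve-∀ ℚ-almostCommutativeRing

  pivotStep-pivotRow : A p zero ≢ 0ℚ → (pivotStep A p *ᵥ w) p ≡ 0ℚ
  pivotStep-pivotRow a≢0 = begin
    (pivotStep A p *ᵥ w) p                    ≡⟨ pivotStep-*ᵥ p ⟩
    S p - A p zero * recip (A p zero) * S p   ≡⟨ cong (λ t → S p - t * S p) a*a⁻¹≡1 ⟩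
    S p - 1ℚ * S p                            ≡⟨ cancel (S p) ⟩
    0ℚ                                        ∎
    where
    a*a⁻¹≡1 : A p zero * recip (A p zero) ≡ 1ℚ
    a*a⁻¹≡1 = trans (ℚP.*-comm (A p zero) _) (recip-*-inverse (A p zero) a≢0)
    cancel : ∀ t → t - 1ℚ * t ≡ 0ℚ
    cancel = solve-∀ ℚ-almostCommutativeRing

pivotStep⇒kernel : ∀ {m n} (A : Mat (ℕ.suc m) (ℕ.suc n)) (p : Fin (ℕ.suc m)) → A p zero ≢ 0ℚ →
                   NontrivialKernel (pivotStep A p ∘ punchIn p) → NontrivialKernel A
pivotStep⇒kernel A p a≢0 (w , (j , wⱼ≢0) , Bw≗0) = extend , (suc j , wⱼ≢0) , kills
  where
  open PivotStep A p w
  kills : A *ᵥ extend ≗ λ _ → 0ℚ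
  kills r with p ≟ r
  ... | yes refl = trans (extend-*ᵥ p) (pivotStep-pivotRow a≢0)
  ... | no  p≢r  = subst (λ r → (A *ᵥ extend) r ≡ 0ℚ) (punchIn-punchOut p≢r)
                         (trans (extend-*ᵥ (punchIn p (punchOut p≢r))) (Bw≗0 (punchOut p≢r)))

wide⇒kernel : ∀ {m n} → m ℕ.< n → (A : Mat m n) → NontrivialKernel A
wide⇒kernel {n = ℕ.zero} () A
wide⇒kernel {ℕ.zero}  {ℕ.suc n} _ A = zeroFirstColumn⇒kernel A (λ ())
wide⇒kernel {ℕ.suc m} {ℕ.suc n} (s≤s m<n) A with all? (λ i → A i zero ℚP.≟ 0ℚ)
... | yes col≡0 = zeroFirstColumn⇒kernel A col≡0
... | no  col≢0 with ¬∀⟶∃¬ (ℕ.suc m) (λ i → A i zero ≡ 0ℚ) (λ i → A i zero ℚP.≟ 0ℚ) col≢0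
...   | p , a≢0 = pivotStep⇒kernel A p a≢0 (wide⇒kernel m<n (pivotStep A p ∘ punchIn p))

negated⇒eigenvalue-1 : ∀ {n} (A : Mat n n) (x : Fin n → ℚ) → (∃ λ a → x a ≢ 0ℚ) →
                       A *ᵥ x ≗ (λ a → - x a) → IsEigenvalue A (- 1ℚ)
negated⇒eigenvalue-1 A x x≢0 Ax≗-x = x , x≢0 , λ a → trans (Ax≗-x a) (neg≡-1* (x a))
  where
  neg≡-1* : ∀ t → - t ≡ - 1ℚ * t
  neg≡-1* = solve-∀ ℚ-almostCommutativeRing

surjective-∘-nonzero : ∀ {n k} {g : Fin n → Fin k} → Surjective _≡_ _≡_ g →
                       {z : Fin k → ℚ} → (∃ λ j → z j ≢ 0ℚ) → ∃ λ a → z (g a) ≢ 0ℚ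
surjective-∘-nonzero surj {z} (j , zⱼ≢0) with surj j
... | a , g≡j = a , subst (λ f → z f ≢ 0ℚ) (sym (g≡j refl)) zⱼ≢0

gramKernel-∘ : ∀ {n k l} (g : Fin n → Fin k) (h : Fin n → Fin l) (z : Fin k → ℚ) →
               ((Incidence.incidence h ᵀ) · Incidence.incidence g) *ᵥ z ≗ (λ _ → 0ℚ) →
               (Incidence.incidence h ᵀ) *ᵥ (z ∘ g) ≗ (λ _ → 0ℚ)
gramKernel-∘ {n} {k} {l} g h z Kz≗0 f = begin
  (Hᵀ *ᵥ (z ∘ g)) f     ≡⟨ *ᵥ-congʳ Hᵀ (sym ∘ Incidence.incidence-*ᵥ g z) f ⟩
  (Hᵀ *ᵥ (G *ᵥ z)) f    ≡⟨ ·-*ᵥ-assoc Hᵀ G z f ⟨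
  ((Hᵀ · G) *ᵥ z) f     ≡⟨ Kz≗0 f ⟩
  0ℚ                    ∎
  where
  G : Mat n k
  G = Incidence.incidence g
  Hᵀ : Mat l n
  Hᵀ = Incidence.incidence h ᵀ

module _ (X : OrientableMap) where
  open OrientableMap X

  fewerVertices⇒eigenvalue-1 : nV ℕ.< nF → IsEigenvalue (Umat X) (- 1ℚ)
  fewerVertices⇒eigenvalue-1 nV<nF with wide⇒kernel nV<nF ((Nmat X ᵀ) · Mmat X)
  ... | z , z≢0 , NᵀMz≗0 = negated⇒eigenvalue-1 (Umat X) x (surjective-∘-nonzero face-surj z≢0) Ux≗-x
    where
    x : Fin nA → ℚ
    x = z ∘ face
    Qx≗0 : Qmat X *ᵥ x ≗ λ _ → 0ℚ
    Qx≗0 = Incidence.projection-kills tail (gramKernel-∘ face tail z NᵀMz≗0)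
    Ux≗-x : Umat X *ᵥ x ≗ λ a → - x a
    Ux≗-x a = begin
      (Umat X *ᵥ x) a                               ≡⟨ ·-*ᵥ-assoc (reflection (Pmat X)) (reflection (Qmat X)) x a ⟩
      (reflection (Pmat X) *ᵥ reflection (Qmat X) *ᵥ x) a
        ≡⟨ *ᵥ-congʳ (reflection (Pmat X)) (reflection-negates (Qmat X) Qx≗0) a ⟩
      (reflection (Pmat X) *ᵥ (λ b → - x b)) a      ≡⟨ reflection-fixes (Pmat X) (Incidence.projection-fixes-∘ face (-_ ∘ z)) a ⟩
      - x a                                         ∎

  fewerFaces⇒eigenvalue-1 : nF ℕ.< nV → IsEigenvalue (Umat X) (- 1ℚ)
  fewerFaces⇒eigenvalue-1 nF<nV with wide⇒kernel nF<nV ((Mmat X ᵀ) · Nmat X)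
  ... | z , z≢0 , MᵀNz≗0 = negated⇒eigenvalue-1 (Umat X) x (surjective-∘-nonzero tail-surj z≢0) Ux≗-x
    where
    x : Fin nA → ℚ
    x = z ∘ tail
    Px≗0 : Pmat X *ᵥ x ≗ λ _ → 0ℚ
    Px≗0 = Incidence.projection-kills face (gramKernel-∘ tail face z MᵀNz≗0)
    Ux≗-x : Umat X *ᵥ x ≗ λ a → - x a
    Ux≗-x a = begin
      (Umat X *ᵥ x) a                               ≡⟨ ·-*ᵥ-assoc (reflection (Pmat X)) (reflection (Qmat X)) x a ⟩
      (reflection (Pmat X) *ᵥ reflection (Qmat X) *ᵥ x) a
        ≡⟨ *ᵥ-congʳ (reflection (Pmat X)) (reflection-fixes (Qmat X) (Incidence.projection-fixes-∘ tail z)) a ⟩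
      (reflection (Pmat X) *ᵥ x) a                  ≡⟨ reflection-negates (Pmat X) Px≗0 a ⟩
      - x a                                         ∎

corollary3p2 : (X : OrientableMap) →
    ¬ IsEigenvalue (Umat X) (- 1ℚ) →
    OrientableMap.nV X ≡ OrientableMap.nF X
corollary3p2 X no-1 with <-cmp (OrientableMap.nV X) (OrientableMap.nF X)
... | tri< nV<nF _ _     = ⊥-elim (no-1 (fewerVertices⇒eigenvalue-1 X nV<nF))
... | tri≈ _ nV≡nF _     = nV≡nF
... | tri> _ _ nF<nV     = ⊥-elim (no-1 (fewerFaces⇒eigenvalue-1 X nF<nV))
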